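{- Let $w$ be a non-empty operation sequence with its (unique) decomposition $w=x_1w_1x_2w_2\cdots w_{2m-1}x_{2m}v$, where $m\ge1$, each $x_i\in\{I_1,O_1,I_2,O_2\}$, $x_1\cdots x_{2m}$ is an unbreakable operation sequence, each $w_i$ is a (possibly empty) tsip word and $v$ is an operation sequence. Then $w$ is canonical if and only if all of the following hold: (1) the operation sequence $s=x_1x_2\cdots x_{2m}$ is top happy; (2) each tsip word $w_i$ is standard and outputs eagerly; (3) $v$ is canonical; (4) if some $x_ix_{i+1}$ is $I_1O_2$ or $I_2O_1$, then $w_i$ is non-empty.
   Context: An operation sequence is a word over $\{I_1,I_2,O_1,O_2\}$ with equally many $I$ letters ($I_1,I_2$) as $O$ letters ($O_1,O_2$), every prefix having at least as many $I$ as $O$ letters. A tsip word is an operation sequence where for each $j\in\{1,2\}$ the numbers of $I_j$ and $O_j$ are equal and every prefix has at least as many $I_j$ as $O_j$; a tsip sub-word is a non-empty contiguous factor that is a tsip word. A non-empty operation sequence is unbreakable if it contains no tsip sub-word other than possibly itself and no non-empty proper prefix has equally many $I$ as $O$ letters. A word outputs eagerly if it contains no factor $I_1O_2$ or $I_2O_1$; it is standard if every tsip sub-word begins with $I_1$; it is top happy if whenever $I_2$ or $O_2$ occurs, the number of preceding $I$ letters is at least two more than the number of preceding $O$ letters. An operation sequence is canonical if it outputs eagerly, is standard and is top happy. (The empty operation sequence is canonical.) -}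

module Defs where

open import Data.Nat using (ℕ; zero; suc; _+_; _≤_)
open import Data.Fin using (Fin; zero; suc)
open import Data.List using (List; []; _∷_; _++_; tabulate)
open import Data.Product using (_×_)
open import Data.Sum using (_⊎_)
open import Relation.Binary.PropositionalEquality using (_≡_; _≢_)
open import Relation.Nullary using (¬_)

data Letter : Set where
  I₁ I₂ O₁ O₂ : Letter

Word : Set
Word = List Letter

#I : Word → ℕ
#I [] = 0
#I (I₁ ∷ w) = suc (#I w)
#I (I₂ ∷ w) = suc (#I w)
#I (O₁ ∷ w) = #I w
#I (O₂ ∷ w) = #I w

#O : Word → ℕ
#O [] = 0
#O (I₁ ∷ w) = #O w
#O (I₂ ∷ w) = #O w
#O (O₁ ∷ w) = suc (#O w)
#O (O₂ ∷ w) = suc (#O w)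

count : Letter → Word → ℕ
count a [] = 0
count I₁ (I₁ ∷ w) = suc (count I₁ w)
count I₂ (I₂ ∷ w) = suc (count I₂ w)
count O₁ (O₁ ∷ w) = suc (count O₁ w)
count O₂ (O₂ ∷ w) = suc (count O₂ w)
count a (_ ∷ w) = count a w

OpSeq : Word → Set
OpSeq w = (#I w ≡ #O w) × (∀ u v → u ++ v ≡ w → #O u ≤ #I u)

Tsip : Word → Set
Tsip w = OpSeq w
  × (count I₁ w ≡ count O₁ w) × (∀ u v → u ++ v ≡ w → count O₁ u ≤ count I₁ u)
  × (count I₂ w ≡ count O₂ w) × (∀ u v → u ++ v ≡ w → count O₂ u ≤ count I₂ u)

TsipSubWord : Word → Word → Word → Word → Set
TsipSubWord w a b c = (a ++ b ++ c ≡ w) × (b ≢ []) × Tsip b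

Unbreakable : Word → Set
Unbreakable w = OpSeq w × (w ≢ [])
  × (∀ a b c → TsipSubWord w a b c → b ≡ w)
  × (∀ u v → u ++ v ≡ w → u ≢ [] → v ≢ [] → #I u ≢ #O u)

OutputsEagerly : Word → Set
OutputsEagerly w = ∀ a c → (a ++ I₁ ∷ O₂ ∷ c ≢ w) × (a ++ I₂ ∷ O₁ ∷ c ≢ w)

Standard : Word → Set
Standard w = ∀ a b c → TsipSubWord w a b c → ∀ y b' → b ≡ y ∷ b' → y ≡ I₁

TopHappy : Word → Set
TopHappy w = ∀ u y v → u ++ y ∷ v ≡ w → (y ≡ I₂ ⊎ y ≡ O₂) → 2 + #O u ≤ #I u

Canonical : Word → Set
Canonical w = OpSeq w × OutputsEagerly w × Standard w × TopHappy w

-- x₁ w₁ x₂ w₂ ⋯ w_n x_{n+1}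
weave : ∀ n → (Fin (suc n) → Letter) → (Fin n → Word) → Word
weave zero x ws = x zero ∷ []
weave (suc n) x ws = x zero ∷ ws zero ++ weave n (λ i → x (suc i)) (λ i → ws (suc i))

letters : ∀ n → (Fin (suc n) → Letter) → Word
letters n x = tabulate x

BadPair : Letter → Letter → Set
BadPair a b = ((a ≡ I₁) × (b ≡ O₂)) ⊎ ((a ≡ I₂) × (b ≡ O₁))

module Submission where

-- Follow three heights along a word: #I − #O and, for each j, #I_j − #O_j. The tsip words are exactly the
-- words on which both stack heights describe Dyck paths, so inserting them between the letters of
-- s = x₁ ⋯ x_2m leaves the heights at the letters unchanged: a prefix of w ending in the gap after x_i has
-- the height of x₁ ⋯ x_i plus that of a prefix of the gap. This gives the operation-sequence property, and
-- top happiness: at a letter x_i it is that of s, and inside a gap both x₁ ⋯ x_i (a proper prefix of the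
-- unbreakable s) and the part of the standard tsip gap before any I₂ or O₂ have positive height.
-- A tsip factor of w starting at a letter x_i with i > 1 would cast a shadow on s that is either a proper
-- tsip factor or a proper suffix of nonnegative height, both impossible for an unbreakable s; hence a tsip
-- factor starts at x₁ (which is I₁), or stays inside one gap, or lies in v. Eagerness only has to be checked
-- at the junctions x_i w_i x_{i+1}, where a nonempty gap starts with an I letter and ends with an O letter.
-- Conversely, the w_i and v are factors of w, and prefixes of s lift to prefixes of w of the same height.

open import Defs
open import Data.Nat using (ℕ; suc; _*_; _∸_; _≤_)
open import Data.Fin using (Fin; inject₁) renaming (suc to fsuc)
open import Data.List using (List; _++_; [])
open import Data.Product using (_×_)
open import Function.Bundles using (_⇔_)
open import Relation.Binary.PropositionalEquality using (_≢_)

open import Data.Empty using (⊥; ⊥-elim)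
open import Data.Fin using () renaming (zero to fzero)
open import Data.Integer as ℤ using (ℤ; +_; 0ℤ; 1ℤ; -1ℤ; _+_; -_; _-_; +≤+)
import Data.Integer.Properties as ℤₚ
open import Algebra.Properties.CommutativeSemigroup ℤₚ.+-commutativeSemigroup using (interchange)
open import Data.Integer.Tactic.RingSolver using (solve-∀)
open import Data.List using (_∷_; _∷ʳ_; head; last; length)
open import Data.List.Properties using (++-assoc; ++-identityʳ; ∷-injective; length-++-≤ˡ; length-++-≤ʳ)
open import Data.List.Relation.Unary.Linked as Linked using (Linked; []; [-]; _∷_; _∷′_)
open import Data.List.Relation.Unary.Linked.Properties using (++⁺)
open import Data.Maybe using (Maybe; just; nothing)
open import Data.Maybe.Relation.Binary.Connected using (Connected; just; just-nothing; nothing-just; nothing)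
open import Data.Nat as ℕ using (zero)
import Data.Nat.Properties as ℕₚ
open import Data.Product using (_,_; proj₁; proj₂; ∃; ∃₂)
import Data.Product as Product
open import Data.Sum using (_⊎_; inj₁; inj₂)
open import Data.Unit using (tt)
open import Function.Base using (_∘_)
open import Function.Bundles using (mk⇔)
open import Relation.Binary.PropositionalEquality
  using (_≡_; refl; sym; trans; cong; cong₂; subst; subst₂; module ≡-Reasoning)
open import Relation.Nullary using (¬_; yes; no; contradiction)

data Measure : Set where
  total first second : Measure

δ : Measure → Letter → ℤ
δ total  I₁ = 1ℤ
δ total  I₂ = 1ℤ
δ total  O₁ = -1ℤ
δ total  O₂ = -1ℤ
δ first  I₁ = 1ℤ
δ first  O₁ = -1ℤ
δ first  _  = 0ℤ
δ second I₂ = 1ℤ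
δ second O₂ = -1ℤ
δ second _  = 0ℤ

height : Measure → Word → ℤ
height μ []      = 0ℤ
height μ (y ∷ w) = δ μ y + height μ w

ins outs : Measure → Word → ℕ
ins total  = #I
ins first  = count I₁
ins second = count I₂
outs total  = #O
outs first  = count O₁
outs second = count O₂

height-++ : ∀ μ u w → height μ (u ++ w) ≡ height μ u + height μ w
height-++ μ []      w = sym (ℤₚ.+-identityˡ _)
height-++ μ (y ∷ u) w =
  trans (cong (_+_ (δ μ y)) (height-++ μ u w)) (sym (ℤₚ.+-assoc (δ μ y) _ _))

height-++-balanced : ∀ {μ} t {u} → height μ t ≡ 0ℤ → height μ (t ++ u) ≡ height μ u
height-++-balanced {μ} t {u} t≡0 =
  trans (height-++ μ t u) (trans (cong (_+ height μ u) t≡0) (ℤₚ.+-identityˡ _))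

δ-total : ∀ y → δ total y ≡ δ first y + δ second y
δ-total I₁ = refl
δ-total I₂ = refl
δ-total O₁ = refl
δ-total O₂ = refl

height-total : ∀ w → height total w ≡ height first w + height second w
height-total []      = refl
height-total (y ∷ w) =
  trans (cong₂ _+_ (δ-total y) (height-total w))
        (interchange (δ first y) (δ second y) (height first w) (height second w))

private
  +-k-k : ∀ i k → (i + k) - k ≡ i
  +-k-k = solve-∀

  enter : ∀ h {o i} → h + + o ≡ + i → (1ℤ + h) + + o ≡ + suc i
  enter h {o} eq = trans (ℤₚ.+-assoc 1ℤ h (+ o)) (cong (_+_ 1ℤ) eq)

  leave : ∀ h {o i} → h + + o ≡ + i → (-1ℤ + h) + + suc o ≡ + i
  leave h {o} = trans (regroup h (+ o))
    where
    regroup : ∀ h o → (-1ℤ + h) + (1ℤ + o) ≡ h + o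
    regroup = solve-∀

  skip : ∀ h {o i} → h + + o ≡ + i → (0ℤ + h) + + o ≡ + i
  skip h = trans (cong (_+ _) (ℤₚ.+-identityˡ h))

+-cancelʳ-≤ : ∀ {i j} k → i + k ℤ.≤ j + k → i ℤ.≤ j
+-cancelʳ-≤ {i} {j} k le = subst₂ ℤ._≤_ (+-k-k i k) (+-k-k j k) (ℤₚ.+-monoˡ-≤ (- k) le)

+-cancelʳ-≡ : ∀ {i j} k → i + k ≡ j + k → i ≡ j
+-cancelʳ-≡ {i} {j} k eq = trans (sym (+-k-k i k)) (trans (cong (_- k) eq) (+-k-k j k))

height-outs : ∀ μ w → height μ w + + outs μ w ≡ + ins μ w
height-outs total  []       = refl
height-outs first  []       = refl
height-outs second []       = refl
height-outs total  (I₁ ∷ w) = enter (height total w) (height-outs total w)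
height-outs total  (I₂ ∷ w) = enter (height total w) (height-outs total w)
height-outs total  (O₁ ∷ w) = leave (height total w) (height-outs total w)
height-outs total  (O₂ ∷ w) = leave (height total w) (height-outs total w)
height-outs first  (I₁ ∷ w) = enter (height first w) (height-outs first w)
height-outs first  (I₂ ∷ w) = skip  (height first w) (height-outs first w)
height-outs first  (O₁ ∷ w) = leave (height first w) (height-outs first w)
height-outs first  (O₂ ∷ w) = skip  (height first w) (height-outs first w)
height-outs second (I₁ ∷ w) = skip  (height second w) (height-outs second w)
height-outs second (I₂ ∷ w) = enter (height second w) (height-outs second w)
height-outs second (O₁ ∷ w) = skip  (height second w) (height-outs second w)
height-outs second (O₂ ∷ w) = leave (height second w) (height-outs second w)

counts⇒height≥ : ∀ μ k w → k ℕ.+ outs μ w ≤ ins μ w → + k ℤ.≤ height μ w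
counts⇒height≥ μ k w le =
  +-cancelʳ-≤ (+ outs μ w) (subst (+ (k ℕ.+ outs μ w) ℤ.≤_) (sym (height-outs μ w)) (+≤+ le))

height≥⇒counts : ∀ μ k w → + k ℤ.≤ height μ w → k ℕ.+ outs μ w ≤ ins μ w
height≥⇒counts μ k w le =
  ℤₚ.drop‿+≤+ (subst (+ k + + outs μ w ℤ.≤_) (height-outs μ w) (ℤₚ.+-monoˡ-≤ (+ outs μ w) le))

counts-≤-transfer : ∀ {u u′} k → height total u′ ≡ height total u
  → k ℕ.+ #O u′ ≤ #I u′ → k ℕ.+ #O u ≤ #I u
counts-≤-transfer {u} {u′} k eq le =
  height≥⇒counts total k u (subst (+ k ℤ.≤_) eq (counts⇒height≥ total k u′ le))

Dyck : Measure → Word → Set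
Dyck μ w = (height μ w ≡ 0ℤ) × (∀ u z → u ++ z ≡ w → 0ℤ ℤ.≤ height μ u)

CountDyck : Measure → Word → Set
CountDyck μ w = (ins μ w ≡ outs μ w) × (∀ u z → u ++ z ≡ w → outs μ u ≤ ins μ u)

countDyck⇒dyck : ∀ {μ w} → CountDyck μ w → Dyck μ w
countDyck⇒dyck {μ} {w} (balanced , prefixes) =
  +-cancelʳ-≡ (+ outs μ w) (trans (height-outs μ w) (cong +_ balanced)) ,
  λ u z eq → counts⇒height≥ μ 0 u (prefixes u z eq)

dyck⇒countDyck : ∀ {μ w} → Dyck μ w → CountDyck μ w
dyck⇒countDyck {μ} {w} (balanced , prefixes) =
  ℤₚ.+-injective (trans (sym (height-outs μ w)) (cong (_+ + outs μ w) balanced)) ,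
  λ u z eq → height≥⇒counts μ 0 u (prefixes u z eq)

opSeq⇒dyck : ∀ {w} → OpSeq w → Dyck total w
opSeq⇒dyck = countDyck⇒dyck {total}

dyck-total : ∀ {w} → Dyck first w → Dyck second w → Dyck total w
dyck-total {w} (balanced₁ , prefixes₁) (balanced₂ , prefixes₂) =
  trans (height-total w) (cong₂ _+_ balanced₁ balanced₂) ,
  λ u z eq → subst (0ℤ ℤ.≤_) (sym (height-total u))
                   (ℤₚ.+-mono-≤ (prefixes₁ u z eq) (prefixes₂ u z eq))

tsip⇒dyck : ∀ {w} → Tsip w → ∀ μ → Dyck μ w
tsip⇒dyck (opSeq , _ , _ , _ , _)             total  = opSeq⇒dyck opSeq
tsip⇒dyck (_ , balanced₁ , prefixes₁ , _ , _) first  = countDyck⇒dyck {first} (balanced₁ , prefixes₁)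
tsip⇒dyck (_ , _ , _ , balanced₂ , prefixes₂) second = countDyck⇒dyck {second} (balanced₂ , prefixes₂)

dyck⇒tsip : ∀ {w} → Dyck first w → Dyck second w → Tsip w
dyck⇒tsip d₁ d₂ =
  dyck⇒countDyck (dyck-total d₁ d₂) , proj₁ c₁ , proj₂ c₁ , proj₁ c₂ , proj₂ c₂
  where
  c₁ = dyck⇒countDyck d₁
  c₂ = dyck⇒countDyck d₂

nonneg-summands : ∀ {i j} → 0ℤ ℤ.≤ i → 0ℤ ℤ.≤ j → i + j ℤ.≤ 0ℤ → i ≡ 0ℤ × j ≡ 0ℤ
nonneg-summands {i} {j} 0≤i 0≤j i+j≤0 =
  ℤₚ.≤-antisym (ℤₚ.≤-trans i≤i+j i+j≤0) 0≤i ,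
  ℤₚ.≤-antisym (ℤₚ.≤-trans j≤i+j i+j≤0) 0≤j
  where
  i≤i+j = subst (ℤ._≤ i + j) (ℤₚ.+-identityʳ i) (ℤₚ.+-monoʳ-≤ i 0≤j)
  j≤i+j = subst (ℤ._≤ i + j) (ℤₚ.+-identityˡ j) (ℤₚ.+-monoˡ-≤ j 0≤i)

dyck-suffix-balanced : ∀ {μ r t} → Dyck μ (r ++ t) → 0ℤ ℤ.≤ height μ t → height μ t ≡ 0ℤ
dyck-suffix-balanced {μ} {r} {t} (balanced , prefixes) 0≤t =
  proj₂ (nonneg-summands (prefixes r t refl) 0≤t
                         (ℤₚ.≤-reflexive (trans (sym (height-++ μ r t)) balanced)))

dyck-drop : ∀ {μ} t {b} → Dyck μ (t ++ b) → height μ t ≡ 0ℤ → Dyck μ b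
dyck-drop t {b} (balanced , prefixes) t≡0 =
  trans (sym (height-++-balanced t t≡0)) balanced ,
  λ u z eq → subst (0ℤ ℤ.≤_) (height-++-balanced t t≡0)
                   (prefixes (t ++ u) z (trans (++-assoc t u z) (cong (t ++_) eq)))

tsip-drop : ∀ t {b} → Tsip (t ++ b) → height first t ≡ 0ℤ → height second t ≡ 0ℤ → Tsip b
tsip-drop t tsip t≡0₁ t≡0₂ =
  dyck⇒tsip (dyck-drop t (tsip⇒dyck tsip first) t≡0₁) (dyck-drop t (tsip⇒dyck tsip second) t≡0₂)

dyck-head : ∀ {y w} → Dyck total (y ∷ w) → δ total y ≡ 1ℤ
dyck-head {I₁} _ = refl
dyck-head {I₂} _ = refl
dyck-head {O₁} {w} (_ , prefixes) with prefixes (O₁ ∷ []) w refl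
... | ()
dyck-head {O₂} {w} (_ , prefixes) with prefixes (O₂ ∷ []) w refl
... | ()

dyck-last : ∀ {w y} → Dyck total (w ∷ʳ y) → δ total y ≡ -1ℤ
dyck-last {w} {I₁} dyck with dyck-suffix-balanced {r = w} dyck (+≤+ ℕ.z≤n)
... | ()
dyck-last {w} {I₂} dyck with dyck-suffix-balanced {r = w} dyck (+≤+ ℕ.z≤n)
... | ()
dyck-last {y = O₁} _ = refl
dyck-last {y = O₂} _ = refl

NotBad : Letter → Letter → Set
NotBad y y′ = ¬ BadPair y y′

out-notBad : ∀ {y y′} → δ total y ≡ -1ℤ → NotBad y y′
out-notBad () (inj₁ (refl , _))
out-notBad () (inj₂ (refl , _))

in-notBad : ∀ {y y′} → δ total y′ ≡ 1ℤ → NotBad y y′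
in-notBad () (inj₁ (_ , refl))
in-notBad () (inj₂ (_ , refl))

eager⇒linked : ∀ {w} → OutputsEagerly w → Linked NotBad w
eager⇒linked {[]}         _     = []
eager⇒linked {y ∷ []}     _     = [-]
eager⇒linked {y ∷ y′ ∷ w} eager = notBad ∷ eager⇒linked eager-tail
  where
  notBad : NotBad y y′
  notBad (inj₁ (refl , refl)) = proj₁ (eager [] w) refl
  notBad (inj₂ (refl , refl)) = proj₂ (eager [] w) refl
  eager-tail : OutputsEagerly (y′ ∷ w)
  eager-tail a c = Product.map (_∘ cong (y ∷_)) (_∘ cong (y ∷_)) (eager (y ∷ a) c)

linked-notBad : ∀ {w} → Linked NotBad w → ∀ a {y y′} c → a ++ y ∷ y′ ∷ c ≡ w → NotBad y y′
linked-notBad linked []      c refl = Linked.head linked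
linked-notBad linked (_ ∷ a) c refl = linked-notBad (Linked.tail linked) a c refl

linked⇒eager : ∀ {w} → Linked NotBad w → OutputsEagerly w
linked⇒eager linked a c =
  (λ eq → linked-notBad linked a c eq (inj₁ (refl , refl))) ,
  (λ eq → linked-notBad linked a c eq (inj₂ (refl , refl)))

last-snoc : ∀ (w : Word) {y} → last w ≡ just y → ∃ λ u → u ∷ʳ y ≡ w
last-snoc (_ ∷ [])     refl = [] , refl
last-snoc (y ∷ y′ ∷ w) eq   = Product.map (y ∷_) (cong (y ∷_)) (last-snoc (y′ ∷ w) eq)

dyck-last-connected : ∀ {g} → Dyck total g → (m : Maybe Letter) → Connected NotBad (last g) m
dyck-last-connected {g} dyck m with last g in eq
dyck-last-connected     _    nothing  | nothing = nothing
dyck-last-connected     _    (just _) | nothing = nothing-just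
dyck-last-connected     _    nothing  | just _  = just-nothing
dyck-last-connected {g} dyck (just _) | just _  =
  just (out-notBad (dyck-last (subst (Dyck total) (sym (proj₂ (last-snoc g eq))) dyck)))

++-split : ∀ (a c : Word) {b d} → a ++ b ≡ c ++ d →
  (∃ λ e → c ≡ a ++ e × b ≡ e ++ d) ⊎ (∃₂ λ y e → a ≡ c ++ y ∷ e × d ≡ y ∷ e ++ b)
++-split []      c        eq = inj₁ (c , refl , eq)
++-split (y ∷ a) []       eq = inj₂ (y , a , refl , sym eq)
++-split (y ∷ a) (_ ∷ c)  eq with ∷-injective eq
... | refl , eq′ with ++-split a c eq′
...   | inj₁ (e , c≡ , b≡)     = inj₁ (e , cong (y ∷_) c≡ , b≡)
...   | inj₂ (z , e , a≡ , d≡) = inj₂ (z , e , cong (y ∷_) a≡ , d≡)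

++-infix-self : ∀ (p f c : Word) → p ++ f ++ c ≡ f → p ≡ []
++-infix-self []      _ _ _  = refl
++-infix-self (y ∷ p) f c eq = ⊥-elim (ℕₚ.<-irrefl refl (begin-strict
  length f                 ≤⟨ ℕₚ.≤-trans (length-++-≤ˡ f) (length-++-≤ʳ (f ++ c) {p}) ⟩
  length (p ++ f ++ c)     <⟨ ℕₚ.n<1+n _ ⟩
  length (y ∷ p ++ f ++ c) ≡⟨ cong length eq ⟩
  length f                 ∎))
  where open ℕₚ.≤-Reasoning

infix-trans : ∀ (a a′ b c′ c : Word) {f w} → a′ ++ b ++ c′ ≡ f → a ++ f ++ c ≡ w
  → (a ++ a′) ++ b ++ c′ ++ c ≡ w
infix-trans a a′ b c′ c {f} {w} f≡ w≡ = begin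
  (a ++ a′) ++ b ++ c′ ++ c   ≡⟨ ++-assoc a a′ _ ⟩
  a ++ a′ ++ b ++ c′ ++ c     ≡⟨ cong (λ r → a ++ a′ ++ r) (++-assoc b c′ c) ⟨
  a ++ a′ ++ (b ++ c′) ++ c   ≡⟨ cong (a ++_) (++-assoc a′ (b ++ c′) c) ⟨
  a ++ (a′ ++ b ++ c′) ++ c   ≡⟨ cong (λ r → a ++ r ++ c) f≡ ⟩
  a ++ f ++ c                 ≡⟨ w≡ ⟩
  w                           ∎
  where open ≡-Reasoning

standard-infix : ∀ a {f} c {w} → a ++ f ++ c ≡ w → Standard w → Standard f
standard-infix a c w≡ standard a′ b c′ (f≡ , b≢[] , tsip) =
  standard (a ++ a′) b (c′ ++ c) (infix-trans a a′ b c′ c f≡ w≡ , b≢[] , tsip)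

eager-infix : ∀ a {f} c {w} → a ++ f ++ c ≡ w → OutputsEagerly w → OutputsEagerly f
eager-infix a c w≡ eager a′ c′ =
  (λ f≡ → proj₁ (eager (a ++ a′) (c′ ++ c)) (infix-trans a a′ (I₁ ∷ O₂ ∷ []) c′ c f≡ w≡)) ,
  (λ f≡ → proj₂ (eager (a ++ a′) (c′ ++ c)) (infix-trans a a′ (I₂ ∷ O₁ ∷ []) c′ c f≡ w≡))

topHappy-drop : ∀ {w v} → height total w ≡ 0ℤ → TopHappy (w ++ v) → TopHappy v
topHappy-drop {w} w≡0 topHappy u y z eq top =
  counts-≤-transfer {u} {w ++ u} 2 (height-++-balanced w w≡0)
    (topHappy (w ++ u) y z (trans (++-assoc w u _) (cong (w ++_) eq)) top)

topHappy-head : ∀ {y t} → OpSeq (y ∷ t) → TopHappy (y ∷ t) → y ≡ I₁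
topHappy-head {I₁} _ _ = refl
topHappy-head {I₂} _ topHappy with topHappy [] I₂ _ refl (inj₁ refl)
... | ()
topHappy-head {O₁} (_ , prefixes) _ with prefixes (O₁ ∷ []) _ refl
... | ()
topHappy-head {O₂} (_ , prefixes) _ with prefixes (O₂ ∷ []) _ refl
... | ()

standard-tsip-top : ∀ {g r y r″} → Tsip g → Standard g → r ++ y ∷ r″ ≡ g → y ≡ I₂ ⊎ y ≡ O₂
  → 1ℤ ℤ.≤ height total r
standard-tsip-top {r = r} {r″ = r″} tsip _ eq (inj₂ refl) =
  subst (1ℤ ℤ.≤_) (regroup (height total r))
        (ℤₚ.+-monoˡ-≤ 1ℤ (subst (0ℤ ℤ.≤_) (height-++ total r (O₂ ∷ []))
                                (proj₂ (tsip⇒dyck tsip total) (r ∷ʳ O₂) r″ (trans (++-assoc r _ r″) eq))))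
  where
  regroup : ∀ h → (h + (-1ℤ + 0ℤ)) + 1ℤ ≡ h
  regroup = solve-∀
standard-tsip-top {r = r} {r″ = r″} tsip standard eq (inj₁ refl) with height total r ℤ.≟ 0ℤ
... | no r≢0 =
  ℤₚ.i<j⇒suc[i]≤j (ℤₚ.≤∧≢⇒< (proj₂ (tsip⇒dyck tsip total) r (I₂ ∷ r″) eq) (r≢0 ∘ sym))
... | yes r≡0 =
  contradiction (standard r (I₂ ∷ r″) [] (I₂-factor , (λ ()) , I₂-suffix-tsip) I₂ r″ refl) (λ ())
  where
  I₂-factor = trans (cong (r ++_) (++-identityʳ _)) eq
  nonneg = λ μ → proj₂ (tsip⇒dyck tsip μ) r (I₂ ∷ r″) eq
  colours-zero =
    nonneg-summands (nonneg first) (nonneg second) (ℤₚ.≤-reflexive (trans (sym (height-total r)) r≡0))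
  I₂-suffix-tsip = tsip-drop r (subst Tsip (sym eq) tsip) (proj₁ colours-zero) (proj₂ colours-zero)

unbreakable-prefix : ∀ {s p q} → Unbreakable s → p ++ q ≡ s → p ≢ [] → q ≢ []
  → 1ℤ ℤ.≤ height total p
unbreakable-prefix {p = p} ((_ , prefixes) , _ , _ , unbalanced) eq p≢[] q≢[] =
  counts⇒height≥ total 1 p
    (ℕₚ.≤∧≢⇒< (prefixes p _ eq) (λ e → unbalanced p _ eq p≢[] q≢[] (sym e)))

unbreakable-suffix-negative : ∀ {s p q} → Unbreakable s → p ++ q ≡ s → p ≢ [] → q ≢ []
  → ¬ (0ℤ ℤ.≤ height total q)
unbreakable-suffix-negative {p = p} {q} unb eq p≢[] q≢[] 0≤q =
  1≰0 (subst (1ℤ ℤ.≤_) p+q≡0 (ℤₚ.+-mono-≤ (unbreakable-prefix unb eq p≢[] q≢[]) 0≤q))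
  where
  p+q≡0 = trans (sym (height-++ total p q)) (trans (cong (height total) eq) (proj₁ (opSeq⇒dyck (proj₁ unb))))
  1≰0 : ¬ (1ℤ ℤ.≤ 0ℤ)
  1≰0 (+≤+ ())

-- Woven P s w: w = x₁ g₁ x₂ g₂ ⋯ g_{k-1} x_k where s = x₁ ⋯ x_k and each gap g_i is a tsip word
-- satisfying P; the decomposition of the theorem, with weave as its functional form.
data Woven (P : Word → Set) : Word → Word → Set where
  [_]      : ∀ y → Woven P (y ∷ []) (y ∷ [])
  _∷⟨_,_⟩_ : ∀ y {g s w} → Tsip g → P g → Woven P s w → Woven P (y ∷ s) (y ∷ g ++ w)

woven-nonempty : ∀ {P s w} → Woven P s w → s ≢ []
woven-nonempty [ _ ]            ()
woven-nonempty (_ ∷⟨ _ , _ ⟩ _) ()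

woven-head : ∀ {P s w v y z} → Woven P s w → y ∷ z ≡ w ++ v → ∃ λ t → s ≡ y ∷ t
woven-head [ _ ]            refl = [] , refl
woven-head (_ ∷⟨ _ , _ ⟩ _) refl = _ , refl

weave-woven : ∀ {P} n x (ws : Fin n → Word) → (∀ i → Tsip (ws i)) → (∀ i → P (ws i))
  → Woven P (letters n x) (weave n x ws)
weave-woven zero    x ws tsips ps = [ x fzero ]
weave-woven (suc n) x ws tsips ps =
  x fzero ∷⟨ tsips fzero , ps fzero ⟩
  weave-woven n (λ i → x (fsuc i)) (λ i → ws (fsuc i)) (λ i → tsips (fsuc i)) (λ i → ps (fsuc i))

height-woven : ∀ {P s w} → Woven P s w → ∀ μ → height μ w ≡ height μ s
height-woven [ _ ]                         _ = refl
height-woven (_∷⟨_,_⟩_ y {g} tsip _ woven) μ =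
  cong (_+_ (δ μ y)) (trans (height-++-balanced g (proj₁ (tsip⇒dyck tsip μ))) (height-woven woven μ))

height-woven-++ : ∀ {P s w b r} → Woven P s w → b ≡ w ++ r
  → ∀ μ → height μ b ≡ height μ s + height μ r
height-woven-++ {w = w} {r = r} woven refl μ =
  trans (height-++ μ w r) (cong (_+ height μ r) (height-woven woven μ))

woven-balanced : ∀ {P s w} → Woven P s w → OpSeq s → height total w ≡ 0ℤ
woven-balanced woven opSeq = trans (height-woven woven total) (proj₁ (opSeq⇒dyck opSeq))

woven-lift : ∀ {P s w u y z} → Woven P s w → u ++ y ∷ z ≡ s
  → ∃₂ λ u′ z′ → u′ ++ y ∷ z′ ≡ w × ∀ μ → height μ u′ ≡ height μ u
woven-lift {u = []}        [ _ ]            refl = [] , [] , refl , λ _ → refl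
woven-lift {u = _ ∷ []}    [ _ ]            ()
woven-lift {u = _ ∷ _ ∷ _} [ _ ]            ()
woven-lift {u = []}        (_ ∷⟨ _ , _ ⟩ _) refl = [] , _ , refl , λ _ → refl
woven-lift {u = _ ∷ _}     (_∷⟨_,_⟩_ y {g} tsip _ woven) refl =
  let u′ , z′ , w≡ , heights = woven-lift woven refl
  in y ∷ g ++ u′ , z′ , cong (y ∷_) (trans (++-assoc g u′ _) (cong (g ++_) w≡)) ,
     λ μ → cong (_+_ (δ μ y)) (trans (height-++-balanced g (proj₁ (tsip⇒dyck tsip μ))) (heights μ))

woven-topHappy-letters : ∀ {P s w v} → Woven P s w → TopHappy (w ++ v) → TopHappy s
woven-topHappy-letters {v = v} woven topHappy u y z eq top =
  let u′ , z′ , w≡ , heights = woven-lift woven eq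
  in counts-≤-transfer {u} {u′} 2 (heights total)
       (topHappy u′ y (z′ ++ v) (trans (sym (++-assoc u′ (y ∷ z′) v)) (cong (_++ v) w≡)) top)

-- Where a nonempty prefix b of w ++ v ends: beyond w, or in the gap g that follows the letters F of s,
-- with r the part of g inside b.
data Cut (P : Word → Set) (s w v b c : Word) : Set where
  beyond : ∀ e → b ≡ w ++ e → e ++ c ≡ v → Cut P s w v b c
  in-gap : ∀ {F ŵ g G w₂} r r′ → Woven P F ŵ → Tsip g → P g → Woven P G w₂ → F ++ G ≡ s
         → b ≡ ŵ ++ r → r ++ r′ ≡ g → c ≡ r′ ++ w₂ ++ v → Cut P s w v b c

cut : ∀ {P s w v b c} → Woven P s w → b ≢ [] → b ++ c ≡ w ++ v → Cut P s w v b c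
cut {b = []}    _ b≢[] _ = ⊥-elim (b≢[] refl)
cut {b = _ ∷ b} [ _ ] _ refl = beyond b refl refl
cut {v = v} {b = _ ∷ b} (_∷⟨_,_⟩_ y {g} {w = w} tsip p woven) _ eq with ∷-injective eq
... | refl , eq′ with ++-split b g (trans eq′ (++-assoc g w v))
...   | inj₁ (r′ , refl , refl) = in-gap b r′ [ y ] tsip p woven refl refl refl refl
...   | inj₂ (d , e , refl , w≡) with cut woven (λ ()) (sym w≡)
...     | beyond e′ de≡ ev =
          beyond e′ (cong (y ∷_) (trans (cong (g ++_) de≡) (sym (++-assoc g w e′)))) ev
...     | in-gap {ŵ = ŵ} r r′ wF tsip′ p′ wG FG de≡ rg c≡ =
          in-gap r r′ (y ∷⟨ tsip , p ⟩ wF) tsip′ p′ wG (cong (y ∷_) FG)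
                 (cong (y ∷_) (trans (cong (g ++_) de≡) (sym (++-assoc g ŵ r)))) rg c≡

woven-prefix-dyck : ∀ {P F ŵ g r r′ μ} → Woven P F ŵ → Tsip g → r ++ r′ ≡ g
  → Dyck μ (ŵ ++ r) → Dyck μ F
woven-prefix-dyck {F = F} {ŵ} {r = r} {r′} {μ} wF tsip rg (balanced , prefixes) = F≡0 , F-prefixes
  where
  ŵ≡0 : height μ ŵ ≡ 0ℤ
  ŵ≡0 = proj₁ (nonneg-summands (prefixes ŵ r refl) (proj₂ (tsip⇒dyck tsip μ) r r′ rg)
                               (ℤₚ.≤-reflexive (trans (sym (height-++ μ ŵ r)) balanced)))
  F≡0 : height μ F ≡ 0ℤ
  F≡0 = trans (sym (height-woven wF μ)) ŵ≡0
  F-prefixes : ∀ u z → u ++ z ≡ F → 0ℤ ℤ.≤ height μ u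
  F-prefixes u [] eq = ℤₚ.≤-reflexive (sym (trans (cong (height μ) (trans (sym (++-identityʳ u)) eq)) F≡0))
  F-prefixes u (y ∷ z) eq =
    let u′ , z′ , ŵ≡ , heights = woven-lift wF eq
    in subst (0ℤ ℤ.≤_) (heights μ)
             (prefixes u′ (y ∷ z′ ++ r) (trans (sym (++-assoc u′ (y ∷ z′) r)) (cong (_++ r) ŵ≡)))

woven-prefix-tsip : ∀ {P F ŵ g r r′} → Woven P F ŵ → Tsip g → r ++ r′ ≡ g → Tsip (ŵ ++ r) → Tsip F
woven-prefix-tsip wF tsip-g rg tsip =
  dyck⇒tsip (woven-prefix-dyck wF tsip-g rg (tsip⇒dyck tsip first))
            (woven-prefix-dyck wF tsip-g rg (tsip⇒dyck tsip second))

no-tsip-at-inner-letter : ∀ {P s p s′ w′ v b c} → Unbreakable s → p ++ s′ ≡ s → p ≢ []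
  → Woven P s′ w′ → Tsip b → b ≢ [] → b ++ c ≡ w′ ++ v → ⊥
no-tsip-at-inner-letter {p = p} {w′ = w′} unb@(_ , _ , tsip-factor-is-whole , _) ps p≢[] woven tsip b≢[] eq
  with cut woven b≢[] eq
... | beyond e b≡ _ =
  unbreakable-suffix-negative unb ps p≢[] (woven-nonempty woven)
    (subst (0ℤ ℤ.≤_) (height-woven woven total) (proj₂ (tsip⇒dyck tsip total) w′ e (sym b≡)))
... | in-gap {F = F} {G = G} _ _ wF tsip-g _ _ FG b≡ rg _ =
  p≢[] (++-infix-self p F G (trans pFG (sym F≡s)))
  where
  pFG = trans (cong (p ++_) FG) ps
  F-tsip = woven-prefix-tsip wF tsip-g rg (subst Tsip b≡ tsip)
  F≡s = tsip-factor-is-whole p F G (pFG , woven-nonempty wF , F-tsip)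

tsip-in-gap : ∀ {P s F G w₂ v g r t b c} → Unbreakable s → F ++ G ≡ s → F ≢ [] → Woven P G w₂
  → Tsip g → r ++ t ≡ g → Tsip b → b ++ c ≡ t ++ w₂ ++ v → ∃ λ e → t ≡ b ++ e
tsip-in-gap {r = r} {t} {b} unb FG F≢[] wG tsip-g rt≡g tsip-b eq with ++-split b t eq
... | inj₁ (e , t≡ , _)        = e , t≡
... | inj₂ (d , e , b≡ , w₂v≡) =
  ⊥-elim (no-tsip-at-inner-letter unb FG F≢[] wG rest-tsip (λ ()) (sym w₂v≡))
  where
  t≡0 : ∀ μ → height μ t ≡ 0ℤ
  t≡0 μ = dyck-suffix-balanced {r = r} (subst (Dyck μ) (sym rt≡g) (tsip⇒dyck tsip-g μ))
                                       (proj₂ (tsip⇒dyck tsip-b μ) t (d ∷ e) (sym b≡))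
  rest-tsip : Tsip (d ∷ e)
  rest-tsip = tsip-drop t (subst Tsip b≡ tsip-b) (t≡0 first) (t≡0 second)

woven-opSeq : ∀ {P s w v} → Woven P s w → OpSeq s → OpSeq v → OpSeq (w ++ v)
woven-opSeq {w = w} {v} woven opSeq-s opSeq-v =
  dyck⇒countDyck (trans (height-++-balanced w w≡0) (proj₁ (opSeq⇒dyck opSeq-v)) , prefixes)
  where
  w≡0 = woven-balanced woven opSeq-s
  prefixes : ∀ u z → u ++ z ≡ w ++ v → 0ℤ ℤ.≤ height total u
  prefixes []      _ _  = ℤₚ.≤-refl
  prefixes (_ ∷ _) z eq with cut woven (λ ()) eq
  ... | beyond e u≡ ev =
    subst (0ℤ ℤ.≤_) (sym (trans (cong (height total) u≡) (height-++-balanced w w≡0)))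
          (proj₂ (opSeq⇒dyck opSeq-v) e z ev)
  ... | in-gap {F = F} {G = G} r r′ wF tsip-g _ _ FG u≡ rg _ =
    subst (0ℤ ℤ.≤_) (sym (height-woven-++ wF u≡ total))
          (ℤₚ.+-mono-≤ (proj₂ (opSeq⇒dyck opSeq-s) F G FG) (proj₂ (tsip⇒dyck tsip-g total) r r′ rg))

woven-topHappy : ∀ {s w v} → Woven Standard s w → Unbreakable s → TopHappy s → TopHappy v
  → TopHappy (w ++ v)
woven-topHappy {w = w} {v} woven unb topHappy-s topHappy-v u y z eq top =
  height≥⇒counts total 2 u (top-height u eq)
  where
  w≡0 = woven-balanced woven (proj₁ unb)
  top-height : ∀ u → u ++ y ∷ z ≡ w ++ v → + 2 ℤ.≤ height total u
  top-height [] eq =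
    let t , s≡ = woven-head woven eq in counts⇒height≥ total 2 [] (topHappy-s [] y t (sym s≡) top)
  top-height u@(_ ∷ _) eq with cut woven (λ ()) eq
  ... | beyond e u≡ ev =
    subst (+ 2 ℤ.≤_) (sym (trans (cong (height total) u≡) (height-++-balanced w w≡0)))
          (counts⇒height≥ total 2 e (topHappy-v e y z ev top))
  ... | in-gap {F = F} r [] wF tsip-g _ wG FG u≡ rg c≡ =
    let t , G≡ = woven-head wG c≡
        F-top = topHappy-s F y t (trans (cong (F ++_) (sym G≡)) FG) top
    in subst (+ 2 ℤ.≤_) (sym (height-woven-++ wF u≡ total))
             (ℤₚ.+-mono-≤ (counts⇒height≥ total 2 F F-top) (proj₂ (tsip⇒dyck tsip-g total) r [] rg))
  ... | in-gap _ (_ ∷ _) wF tsip-g standard-g wG FG u≡ rg refl =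
    subst (+ 2 ℤ.≤_) (sym (height-woven-++ wF u≡ total))
          (ℤₚ.+-mono-≤ (unbreakable-prefix unb FG (woven-nonempty wF) (woven-nonempty wG))
                       (standard-tsip-top tsip-g standard-g rg top))

woven-standard : ∀ {s w v} → Woven Standard s w → Unbreakable s → TopHappy s → Standard v
  → Standard (w ++ v)
woven-standard woven unb topHappy-s _ [] _ _ (eq , _ , _) y b′ refl =
  let t , s≡ = woven-head woven eq
  in topHappy-head (subst OpSeq s≡ (proj₁ unb)) (subst TopHappy s≡ topHappy-s)
woven-standard woven unb _ standard-v a@(_ ∷ _) b c (eq , b≢[] , tsip) y b′ refl
  with cut {b = a} woven (λ ()) eq
... | beyond e _ ev = standard-v e b c (ev , b≢[] , tsip) y b′ refl
... | in-gap _ [] wF _ _ wG FG _ _ c≡ =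
  ⊥-elim (no-tsip-at-inner-letter unb FG (woven-nonempty wF) wG tsip b≢[] c≡)
... | in-gap r (_ ∷ _) wF tsip-g standard-g wG FG _ rg c≡ =
  let e , t≡ = tsip-in-gap unb FG (woven-nonempty wF) wG tsip-g rg tsip c≡
  in standard-g r b e (trans (cong (r ++_) (sym t≡)) rg , b≢[] , tsip) y b′ refl

weave-head : ∀ n x (ws : Fin n → Word) → ∃ λ c → weave n x ws ≡ x fzero ∷ c
weave-head zero    _ _ = [] , refl
weave-head (suc _) _ _ = _ , refl

weave-gap : ∀ n x (ws : Fin n → Word) i →
  ∃₂ λ a c → a ++ x (inject₁ i) ∷ ws i ++ x (fsuc i) ∷ c ≡ weave n x ws
weave-gap (suc n) x ws fzero =
  let c , W≡ = weave-head n (λ i → x (fsuc i)) (λ i → ws (fsuc i))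
  in [] , c , cong (λ r → x fzero ∷ ws fzero ++ r) (sym W≡)
weave-gap (suc n) x ws (fsuc i) =
  let a , c , W≡ = weave-gap n (λ i → x (fsuc i)) (λ i → ws (fsuc i)) i
  in x fzero ∷ ws fzero ++ a , c ,
     cong (x fzero ∷_) (trans (++-assoc (ws fzero) a _) (cong (ws fzero ++_) W≡))

weave-gap-infix : ∀ n x (ws : Fin n → Word) v i → ∃₂ λ a c → a ++ ws i ++ c ≡ weave n x ws ++ v
weave-gap-infix n x ws v i =
  let a , c , W≡ = weave-gap n x ws i
  in a ∷ʳ x (inject₁ i) , x (fsuc i) ∷ c ++ v ,
     infix-trans a (x (inject₁ i) ∷ []) (ws i) (x (fsuc i) ∷ c) v refl
                 (trans (sym (++-assoc a _ v)) (cong (_++ v) W≡))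

weave-adjacent : ∀ n x (ws : Fin n → Word) v → OutputsEagerly (weave n x ws ++ v)
  → ∀ i → BadPair (x (inject₁ i)) (x (fsuc i)) → ws i ≢ []
weave-adjacent n x ws v eager i badPair ws≡[] =
  let a , c , W≡ = weave-gap n x ws i
      adjacent = subst (λ g → a ++ x (inject₁ i) ∷ g ++ x (fsuc i) ∷ c ≡ weave n x ws) ws≡[] W≡
  in linked-notBad (eager⇒linked eager) a (c ++ v) (trans (sym (++-assoc a _ v)) (cong (_++ v) adjacent)) badPair

weave-linked : ∀ n x (ws : Fin n → Word) {v} → (∀ i → Dyck total (ws i)) → (∀ i → Linked NotBad (ws i))
  → (∀ i → BadPair (x (inject₁ i)) (x (fsuc i)) → ws i ≢ [])
  → Connected NotBad (last (letters n x)) (head v) → Linked NotBad v → Linked NotBad (weave n x ws ++ v)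
weave-linked zero    _ _ _ _ _ end linked-v = end ∷′ linked-v
weave-linked (suc n) x ws {v} dyck linked bad end linked-v =
  subst (Linked NotBad) (cong (x fzero ∷_) (sym (++-assoc (ws fzero) W′ v)))
        (into-gap (ws fzero) refl ∷′ ++⁺ (linked fzero) (dyck-last-connected (dyck fzero) _) rest)
  where
  x′ = λ i → x (fsuc i)
  ws′ = λ i → ws (fsuc i)
  W′ = weave n x′ ws′
  rest : Linked NotBad (W′ ++ v)
  rest = weave-linked n x′ ws′ (λ i → dyck (fsuc i)) (λ i → linked (fsuc i)) (λ i → bad (fsuc i))
                      end linked-v
  into-gap : ∀ g → g ≡ ws fzero → Connected NotBad (just (x fzero)) (head (g ++ W′ ++ v))
  into-gap [] g≡ =
    subst (Connected NotBad (just (x fzero))) (cong (λ r → head (r ++ v)) (sym (proj₂ (weave-head n x′ ws′))))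
          (just (λ badPair → bad fzero badPair (sym g≡)))
  into-gap (_ ∷ _) g≡ = just (in-notBad (dyck-head (subst (Dyck total) (sym g≡) (dyck fzero))))

canonical⇒conditions : ∀ n x (ws : Fin n → Word) v → (∀ i → Tsip (ws i)) → OpSeq (letters n x) → OpSeq v
  → Canonical (weave n x ws ++ v)
  → TopHappy (letters n x) × (∀ i → Standard (ws i) × OutputsEagerly (ws i)) × Canonical v
    × (∀ i → BadPair (x (inject₁ i)) (x (fsuc i)) → ws i ≢ [])
canonical⇒conditions n x ws v tsips opSeq-s opSeq-v (_ , eager , standard , topHappy) =
  woven-topHappy-letters woven topHappy ,
  (λ i → let a , c , eq = weave-gap-infix n x ws v i
         in standard-infix a c eq standard , eager-infix a c eq eager) ,
  (opSeq-v , eager-infix W [] v-infix eager , standard-infix W [] v-infix standard ,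
   topHappy-drop (woven-balanced woven opSeq-s) topHappy) ,
  weave-adjacent n x ws v eager
  where
  W = weave n x ws
  woven = weave-woven n x ws tsips (λ _ → tt)
  v-infix : W ++ v ++ [] ≡ W ++ v
  v-infix = cong (W ++_) (++-identityʳ v)

conditions⇒canonical : ∀ n x (ws : Fin n → Word) v → Unbreakable (letters n x) → (∀ i → Tsip (ws i))
  → TopHappy (letters n x) → (∀ i → Standard (ws i) × OutputsEagerly (ws i)) → Canonical v
  → (∀ i → BadPair (x (inject₁ i)) (x (fsuc i)) → ws i ≢ [])
  → Canonical (weave n x ws ++ v)
conditions⇒canonical n x ws v unb tsips topHappy-s gaps (opSeq-v , eager-v , standard-v , topHappy-v) bad =
  woven-opSeq woven (proj₁ unb) opSeq-v ,
  linked⇒eager (weave-linked n x ws (λ i → tsip⇒dyck (tsips i) total) (λ i → eager⇒linked (proj₂ (gaps i)))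
                             bad (dyck-last-connected (opSeq⇒dyck (proj₁ unb)) _) (eager⇒linked eager-v)) ,
  woven-standard woven unb topHappy-s standard-v ,
  woven-topHappy woven unb topHappy-s topHappy-v
  where
  woven = weave-woven n x ws tsips (λ i → proj₁ (gaps i))

mainTheorem11 : (m : ℕ) → 1 ≤ m
    → (x : Fin (suc (2 * m ∸ 1)) → Letter) → (ws : Fin (2 * m ∸ 1) → Word) → (v : Word)
    → Unbreakable (letters (2 * m ∸ 1) x)
    → (∀ i → Tsip (ws i))
    → OpSeq v
    → Canonical (weave (2 * m ∸ 1) x ws ++ v)
      ⇔ (TopHappy (letters (2 * m ∸ 1) x)
         × (∀ i → Standard (ws i) × OutputsEagerly (ws i))
         × Canonical v
         × (∀ i → BadPair (x (inject₁ i)) (x (fsuc i)) → ws i ≢ []))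
mainTheorem11 m _ x ws v unb tsips opSeq-v =
  mk⇔ (canonical⇒conditions n x ws v tsips (proj₁ unb) opSeq-v)
      (λ (topHappy-s , gaps , canonical-v , bad) →
         conditions⇒canonical n x ws v unb tsips topHappy-s gaps canonical-v bad)
  where
  n = 2 * m ∸ 1
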